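{- Let $1\le k\le n$ and $u,w\in S_n$ with $u\le_k w$. Then there exists $z\in S_k\times S_{n-k}$ such that $uz\le_k wz$, $uz$ is anti-Grassmannian of type $(k,n)$, and both factorizations are length additive: $\ell(uz)=\ell(u)+\ell(z)$ and $\ell(wz)=\ell(w)+\ell(z)$.
   Context: $S_k\times S_{n-k}$ is the Young subgroup of $S_n$ fixing the sets $[k]$ and $[k+1,n]$. A permutation is anti-Grassmannian of type $(k,n)$ if it is decreasing on $[k]$ and on $[k+1,n]$ (equivalently, of maximal length in its left coset of $S_k\times S_{n-k}$). $\ell$ is Coxeter length. The $k$-Bruhat order $\le_k$ is the reflexive-transitive closure of the relations $u\lessdot_k w$, meaning $w$ covers $u$ in Bruhat order and $w([k])\ne u([k])$, where $u([k])=\{u(1),\dots,u(k)\}$. -}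

module Defs where

open import Data.Nat using (ℕ; _+_; suc)
open import Data.Fin using (Fin; toℕ; _<_; _<?_)
open import Data.Fin.Permutation using (Permutation′; _⟨$⟩ʳ_; _∘ₚ_; transpose)
open import Data.List using (List; length; filter; cartesianProduct; allFin)
open import Data.Product using (Σ; ∃; _×_; _,_)
open import Relation.Binary.PropositionalEquality using (_≡_; _≢_)
open import Relation.Nullary using (¬_)
open import Relation.Nullary.Decidable using (_×-dec_)
open import Function.Bundles using (_⇔_)

-- Permutations of [n] = {0,...,n-1} (0-indexed; position i stands for i+1).
Perm : ℕ → Set
Perm n = Permutation′ n

-- Product uv as functions: (u · v)(x) = u (v x).
_·_ : ∀ {n} → Perm n → Perm n → Perm n
u · v = v ∘ₚ u

ℓ : ∀ {n} → Perm n → ℕ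
ℓ {n} w = length (filter (λ p → (Σ.proj₁ p <? Σ.proj₂ p) ×-dec (w ⟨$⟩ʳ Σ.proj₂ p <? w ⟨$⟩ʳ Σ.proj₁ p))
                         (cartesianProduct (allFin n) (allFin n)))

BruhatCover : ∀ {n} → Perm n → Perm n → Set
BruhatCover {n} u w =
  Σ (Fin n) λ a → Σ (Fin n) λ b → a ≢ b ×
    ((∀ x → w ⟨$⟩ʳ x ≡ (u · transpose a b) ⟨$⟩ʳ x) × ℓ w ≡ suc (ℓ u))

InImage : ∀ {n} → ℕ → Perm n → Fin n → Set
InImage k u y = ∃ λ i → (toℕ i Data.Nat.< k) × u ⟨$⟩ʳ i ≡ y

SameImage : ∀ {n} → ℕ → Perm n → Perm n → Set
SameImage {n} k u w = ∀ (y : Fin n) → InImage k u y ⇔ InImage k w y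

kCover : ∀ {n} → ℕ → Perm n → Perm n → Set
kCover k u w = BruhatCover u w × ¬ SameImage k u w

data _≤[_]_ {n : ℕ} : Perm n → ℕ → Perm n → Set where
  ≤-refl : ∀ {k u w} → (∀ x → u ⟨$⟩ʳ x ≡ w ⟨$⟩ʳ x) → u ≤[ k ] w
  ≤-step : ∀ {k u v w} → kCover k u v → v ≤[ k ] w → u ≤[ k ] w

-- z ∈ S_k × S_{n-k}: z preserves the set [k] (hence also [k+1,n]).
InYoung : ∀ {n} → ℕ → Perm n → Set
InYoung k z = ∀ i → toℕ i Data.Nat.< k → toℕ (z ⟨$⟩ʳ i) Data.Nat.< k

AntiGrassmannian : ∀ {n} → ℕ → Perm n → Set
AntiGrassmannian k w =
  (∀ i j → i < j → toℕ j Data.Nat.< k → w ⟨$⟩ʳ j < w ⟨$⟩ʳ i) ×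
  (∀ i j → i < j → k Data.Nat.≤ toℕ i → w ⟨$⟩ʳ j < w ⟨$⟩ʳ i)

module Submission where

-- Call v compatible with z when v increases along every inversion
-- of z⁻¹; then ℓ (v z) = ℓ v + ℓ z.  Choose z block-preserving with u z anti-Grassmannian by
-- swapping ascents inside the blocks while any exist (each swap raises ℓ ≤ n²); then u is
-- compatible with z.  The key step: compatibility survives a k-cover u ⋖ₖ v = u (a b).  By the
-- transposition formula (proved by inclusion–exclusion over the rows and columns through a, b)
--   ℓ (u (a b)) = ℓ u + 1 + 2 · #{a < c < b : u a < u c < u b}     (a < b, u a < u b),
-- a Bruhat cover swaps an ascent with no value in between, and a k-cover swaps a ∈ [k] with
-- b ∉ [k]; a case analysis then shows v compatible.  Hence right multiplication by z maps every
-- k-cover of a chain from u to w to a k-cover, and lengths add at both ends.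

open import Defs
open import Data.Nat using (ℕ; _≤_; _+_)
open import Data.Fin.Permutation using ()
open import Data.Product using (Σ; _×_)
open import Relation.Binary.PropositionalEquality using (_≡_)

import Algebra.Properties.CommutativeMonoid.Sum as MonoidSum
import Data.Fin.Permutation.Components as PC
open import Data.Bool using (if_then_else_)
open import Data.Empty using (⊥; ⊥-elim)
open import Data.Fin as F using (Fin; toℕ; _<?_)
open import Data.Fin.Permutation as P using (_⟨$⟩ʳ_; _⟨$⟩ˡ_; flip; inverseˡ; inverseʳ)
open import Data.Fin.Properties as FP using (_≟_)
open import Data.List using (List; length; filter; cartesianProduct; allFin; tabulate; map; _++_)
open import Data.List.Properties using (filter-++; length-++)
open import Data.Nat as ℕ using (zero; suc; _*_; z≤n; s≤s)
open import Data.Nat.Properties as NP using (+-0-commutativeMonoid)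
open import Data.Nat.Solver using (module +-*-Solver)
open import Data.Product using (_,_; proj₁; proj₂)
open import Data.Sum using (_⊎_; inj₁; inj₂; [_,_])
open import Function using (_∘_; id)
open import Function.Bundles using (_⇔_; mk⇔)
open import Function.Properties.Equivalence using () renaming (sym to ⇔-sym; trans to ⇔-trans)
open import Relation.Binary using (tri<; tri≈; tri>)
open import Relation.Binary.PropositionalEquality using (refl; sym; trans; cong; cong₂; subst; subst₂; _≢_; module ≡-Reasoning)
open import Relation.Nullary using (Dec; yes; no; does; ¬_)
open import Relation.Nullary.Decidable using (_×-dec_; _⊎-dec_; _→-dec_; dec-true; dec-false)

open MonoidSum +-0-commutativeMonoid using (sum; sum-permute; ∑-distrib-+; sum-cong-≗)

𝟙 : ∀ {a} {A : Set a} → Dec A → ℕ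
𝟙 d = if does d then 1 else 0

𝟙-yes : ∀ {a} {A : Set a} (d : Dec A) → A → 𝟙 d ≡ 1
𝟙-yes (yes _) _ = refl
𝟙-yes (no ¬a) a = ⊥-elim (¬a a)

𝟙-no : ∀ {a} {A : Set a} (d : Dec A) → ¬ A → 𝟙 d ≡ 0
𝟙-no (yes a) ¬a = ⊥-elim (¬a a)
𝟙-no (no _) _ = refl

𝟙-×-yes : ∀ {A B : Set} (p : Dec A) (q : Dec B) → A → 𝟙 (p ×-dec q) ≡ 𝟙 q
𝟙-×-yes (yes _) q _ = refl
𝟙-×-yes (no ¬a) q a = ⊥-elim (¬a a)

𝟙-⇔ : ∀ {A B : Set} (p : Dec A) (q : Dec B) → (A → B) → (B → A) → 𝟙 p ≡ 𝟙 q
𝟙-⇔ (yes _) (yes _) _ _ = refl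
𝟙-⇔ (no _) (no _) _ _ = refl
𝟙-⇔ (yes a) (no ¬b) f _ = ⊥-elim (¬b (f a))
𝟙-⇔ (no ¬a) (yes b) _ g = ⊥-elim (¬a (g b))

𝟙≤1 : ∀ {a} {A : Set a} (d : Dec A) → 𝟙 d ℕ.≤ 1
𝟙≤1 (yes _) = s≤s z≤n
𝟙≤1 (no _) = z≤n

sum² : ∀ {n} → (Fin n → Fin n → ℕ) → ℕ
sum² A = sum (λ x → sum (A x))

sum²-+ : ∀ {n} (A B : Fin n → Fin n → ℕ) → sum² (λ x y → A x y + B x y) ≡ sum² A + sum² B
sum²-+ A B = trans (sum-cong-≗ (λ x → ∑-distrib-+ (A x) (B x))) (∑-distrib-+ (λ x → sum (A x)) (λ x → sum (B x)))

sum²-cong : ∀ {n} {A B : Fin n → Fin n → ℕ} → (∀ x y → A x y ≡ B x y) → sum² A ≡ sum² B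
sum²-cong e = sum-cong-≗ (λ x → sum-cong-≗ (e x))

sum²-+₃ : ∀ {n} (A B C : Fin n → Fin n → ℕ) → sum² (λ x y → A x y + B x y + C x y) ≡ sum² A + sum² B + sum² C
sum²-+₃ A B C = trans (sum²-+ (λ x y → A x y + B x y) C) (cong (_+ sum² C) (sum²-+ A B))

sum-zero : ∀ {n} (f : Fin n → ℕ) → (∀ i → f i ≡ 0) → sum f ≡ 0
sum-zero {zero} f e = refl
sum-zero {suc n} f e rewrite e F.zero = sum-zero (f ∘ F.suc) (e ∘ F.suc)

sum-point : ∀ {n} (f : Fin n → ℕ) (a : Fin n) → (∀ x → x ≢ a → f x ≡ 0) → sum f ≡ f a
sum-point {suc n} f F.zero e = trans (cong (f F.zero +_) (sum-zero (f ∘ F.suc) (λ i → e (F.suc i) (λ ())))) (NP.+-identityʳ _)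
sum-point {suc n} f (F.suc a) e rewrite e F.zero (λ ()) = sum-point (f ∘ F.suc) a (λ x x≢a → e (F.suc x) (x≢a ∘ FP.suc-injective))

term≤sum : ∀ {n} (f : Fin n → ℕ) (a : Fin n) → f a ℕ.≤ sum f
term≤sum f F.zero = NP.m≤m+n _ _
term≤sum f (F.suc a) = NP.≤-trans (term≤sum (f ∘ F.suc) a) (NP.m≤n+m _ _)

sum≤ : ∀ {n} (f : Fin n → ℕ) c → (∀ i → f i ℕ.≤ c) → sum f ℕ.≤ n * c
sum≤ {zero} f c b = z≤n
sum≤ {suc n} f c b = NP.+-mono-≤ (b F.zero) (sum≤ (f ∘ F.suc) c (b ∘ F.suc))

inv : ∀ {n} → (Fin n → Fin n) → Fin n → Fin n → ℕ
inv h i j = 𝟙 ((i <? j) ×-dec (h j <? h i))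

invs : ∀ {n} → (Fin n → Fin n) → ℕ
invs h = sum² (inv h)

inv-< : ∀ {n} (h : Fin n → Fin n) {i j} → i F.< j → inv h i j ≡ 𝟙 (h j <? h i)
inv-< h {i} {j} i<j = 𝟙-×-yes (i <? j) (h j <? h i) i<j

inv-≮ : ∀ {n} (h : Fin n → Fin n) {i j} → ¬ i F.< j → inv h i j ≡ 0
inv-≮ h {i} {j} i≮j = 𝟙-no ((i <? j) ×-dec (h j <? h i)) (i≮j ∘ proj₁)

invs≤ : ∀ {n} (h : Fin n → Fin n) → invs h ℕ.≤ n * n
invs≤ {n} h = sum≤ (λ i → sum (inv h i)) n row≤
  where
  row≤ : ∀ i → sum (inv h i) ℕ.≤ n
  row≤ i = NP.≤-trans (sum≤ (inv h i) 1 (λ j → 𝟙≤1 ((i <? j) ×-dec (h j <? h i)))) (NP.≤-reflexive (NP.*-identityʳ n))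

private
  length-filter-map : ∀ {a b} {A : Set a} {B : Set b} {P : A → Set} (P? : ∀ x → Dec (P x)) (g : B → A) {m} (h : Fin m → B) →
    length (filter P? (map g (tabulate h))) ≡ sum (λ j → 𝟙 (P? (g (h j))))
  length-filter-map P? g {zero} h = refl
  length-filter-map P? g {suc m} h with P? (g (h F.zero))
  ... | yes _ = cong suc (length-filter-map P? g (h ∘ F.suc))
  ... | no _ = length-filter-map P? g (h ∘ F.suc)

  length-filter-product : ∀ {a b} {A : Set a} {B : Set b} {P : A × B → Set} (P? : ∀ x → Dec (P x)) {m} (f : Fin m → A) (ys : List B) →
    length (filter P? (cartesianProduct (tabulate f) ys)) ≡ sum (λ i → length (filter P? (map (f i ,_) ys)))
  length-filter-product P? {zero} f ys = refl
  length-filter-product {A = A} {B} P? {suc m} f ys = begin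
      length (filter P? (row ++ rest))
    ≡⟨ cong length (filter-++ P? row rest) ⟩
      length (filter P? row ++ filter P? rest)
    ≡⟨ length-++ (filter P? row) ⟩
      length (filter P? row) + length (filter P? rest)
    ≡⟨ cong (length (filter P? row) +_) (length-filter-product P? (f ∘ F.suc) ys) ⟩
      _ ∎
    where
    open ≡-Reasoning
    row rest : List (A × B)
    row = map (f F.zero ,_) ys
    rest = cartesianProduct (tabulate (f ∘ F.suc)) ys

ℓ≡invs : ∀ {n} (w : Perm n) → ℓ w ≡ invs (w ⟨$⟩ʳ_)
ℓ≡invs {n} w = trans (length-filter-product D {n} (λ i → i) (allFin n))
  (sum-cong-≗ (λ i → length-filter-map D (i ,_) {n} (λ j → j)))
  where
  D : (p : Fin n × Fin n) → Dec (proj₁ p F.< proj₂ p × w ⟨$⟩ʳ proj₂ p F.< w ⟨$⟩ʳ proj₁ p)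
  D (i , j) = (i <? j) ×-dec (w ⟨$⟩ʳ j <? w ⟨$⟩ʳ i)

ℓ≤n*n : ∀ {n} (w : Perm n) → ℓ w ℕ.≤ n * n
ℓ≤n*n w = subst (ℕ._≤ _) (sym (ℓ≡invs w)) (invs≤ (w ⟨$⟩ʳ_))

-- v is compatible with z when v increases along every inversion of z⁻¹, i.e. on all
-- positions q < p with z⁻¹ p < z⁻¹ q.  This is exactly what makes ℓ (v · z) = ℓ v + ℓ z.
Compatible : ∀ {n} → Perm n → Perm n → Set
Compatible z v = ∀ p q → z ⟨$⟩ˡ p F.< z ⟨$⟩ˡ q → q F.< p → v ⟨$⟩ʳ q F.< v ⟨$⟩ʳ p

perm-injective : ∀ {n} (u : Perm n) {x y} → u ⟨$⟩ʳ x ≡ u ⟨$⟩ʳ y → x ≡ y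
perm-injective u {x} {y} e = trans (sym (inverseˡ u)) (trans (cong (u ⟨$⟩ˡ_) e) (inverseˡ u))

module _ {n} (z : Perm n) where
  private
    σ : Fin n → Fin n
    σ = z ⟨$⟩ˡ_

  invs-reindex : (h : Fin n → Fin n) → invs h ≡ sum² (λ p q → 𝟙 ((σ p <? σ q) ×-dec (h (σ q) <? h (σ p))))
  invs-reindex h = trans (sum-permute (λ i → sum (inv h i)) (flip z))
    (sum-cong-≗ (λ p → sum-permute (inv h (σ p)) (flip z)))

  -- Pointwise form of length additivity: the pair (σ p, σ q) is an inversion of v ∘ z
  -- iff (p, q) is an inversion of v or (q, p) is an inversion of z⁻¹ (never both).
  inversion-split : (v : Perm n) → Compatible z v → ∀ p q →
    𝟙 ((σ p <? σ q) ×-dec (v ⟨$⟩ʳ q <? v ⟨$⟩ʳ p)) ≡ inv (v ⟨$⟩ʳ_) p q + 𝟙 ((σ p <? σ q) ×-dec (q <? p))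
  inversion-split v compat p q with FP.<-cmp p q
  ... | tri< p<q _ q≮p =
    trans (𝟙-⇔ ((σ p <? σ q) ×-dec (v ⟨$⟩ʳ q <? v ⟨$⟩ʳ p)) ((p <? q) ×-dec (v ⟨$⟩ʳ q <? v ⟨$⟩ʳ p))
            (λ (_ , vq<vp) → p<q , vq<vp) (λ (_ , vq<vp) → σ-ascends vq<vp , vq<vp))
          (sym (trans (cong (inv (v ⟨$⟩ʳ_) p q +_) (𝟙-no ((σ p <? σ q) ×-dec (q <? p)) (q≮p ∘ proj₂))) (NP.+-identityʳ _)))
    where
    σ-ascends : v ⟨$⟩ʳ q F.< v ⟨$⟩ʳ p → σ p F.< σ q
    σ-ascends vq<vp with FP.<-cmp (σ p) (σ q)
    ... | tri< lt _ _ = lt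
    ... | tri≈ _ eq _ = ⊥-elim (FP.<⇒≢ p<q (perm-injective (flip z) eq))
    ... | tri> _ _ gt = ⊥-elim (NP.<-asym vq<vp (compat q p gt p<q))
  ... | tri≈ _ refl _ =
    trans (𝟙-no ((σ p <? σ p) ×-dec (v ⟨$⟩ʳ p <? v ⟨$⟩ʳ p)) (FP.<-irrefl refl ∘ proj₁))
          (sym (cong₂ _+_ (inv-≮ (v ⟨$⟩ʳ_) (FP.<-irrefl refl)) (𝟙-no ((σ p <? σ p) ×-dec (p <? p)) (FP.<-irrefl refl ∘ proj₁))))
  ... | tri> p≮q _ q<p =
    trans (𝟙-⇔ ((σ p <? σ q) ×-dec (v ⟨$⟩ʳ q <? v ⟨$⟩ʳ p)) ((σ p <? σ q) ×-dec (q <? p))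
            (λ (σp<σq , _) → σp<σq , q<p) (λ (σp<σq , _) → σp<σq , compat p q σp<σq q<p))
          (sym (cong (_+ _) (inv-≮ (v ⟨$⟩ʳ_) p≮q)))

  ℓ-via-inverse : ℓ z ≡ sum² (λ p q → 𝟙 ((σ p <? σ q) ×-dec (q <? p)))
  ℓ-via-inverse = trans (ℓ≡invs z) (trans (invs-reindex (z ⟨$⟩ʳ_)) (sum²-cong cancel-z))
    where
    cancel-z : ∀ p q → 𝟙 ((σ p <? σ q) ×-dec (z ⟨$⟩ʳ σ q <? z ⟨$⟩ʳ σ p)) ≡ 𝟙 ((σ p <? σ q) ×-dec (q <? p))
    cancel-z p q rewrite inverseʳ z {q} | inverseʳ z {p} = refl

  ℓ-additive : (v : Perm n) → Compatible z v → ℓ (v · z) ≡ ℓ v + ℓ z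
  ℓ-additive v compat = begin
      ℓ (v · z)
    ≡⟨ ℓ≡invs (v · z) ⟩
      invs (λ x → v ⟨$⟩ʳ (z ⟨$⟩ʳ x))
    ≡⟨ invs-reindex (λ x → v ⟨$⟩ʳ (z ⟨$⟩ʳ x)) ⟩
      sum² (λ p q → 𝟙 ((σ p <? σ q) ×-dec (v ⟨$⟩ʳ (z ⟨$⟩ʳ σ q) <? v ⟨$⟩ʳ (z ⟨$⟩ʳ σ p))))
    ≡⟨ sum²-cong (λ p q → trans (cancel-z p q) (inversion-split v compat p q)) ⟩
      sum² (λ p q → inv (v ⟨$⟩ʳ_) p q + 𝟙 ((σ p <? σ q) ×-dec (q <? p)))
    ≡⟨ sum²-+ (inv (v ⟨$⟩ʳ_)) (λ p q → 𝟙 ((σ p <? σ q) ×-dec (q <? p))) ⟩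
      invs (v ⟨$⟩ʳ_) + sum² (λ p q → 𝟙 ((σ p <? σ q) ×-dec (q <? p)))
    ≡⟨ cong₂ _+_ (sym (ℓ≡invs v)) (sym ℓ-via-inverse) ⟩
      ℓ v + ℓ z ∎
    where
    open ≡-Reasoning
    cancel-z : ∀ p q → 𝟙 ((σ p <? σ q) ×-dec (v ⟨$⟩ʳ (z ⟨$⟩ʳ σ q) <? v ⟨$⟩ʳ (z ⟨$⟩ʳ σ p)))
                     ≡ 𝟙 ((σ p <? σ q) ×-dec (v ⟨$⟩ʳ q <? v ⟨$⟩ʳ p))
    cancel-z p q rewrite inverseʳ z {q} | inverseʳ z {p} = refl

τ : ∀ {n} → Fin n → Fin n → Fin n → Fin n
τ = PC.transpose

τ-at-a : ∀ {n} (a b : Fin n) → τ a b a ≡ b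
τ-at-a a b rewrite dec-true (a ≟ a) refl = refl

τ-at-b : ∀ {n} (a b : Fin n) → a ≢ b → τ a b b ≡ a
τ-at-b a b a≢b rewrite dec-false (b ≟ a) (a≢b ∘ sym) | dec-true (b ≟ b) refl = refl

τ-elsewhere : ∀ {n} (a b x : Fin n) → x ≢ a → x ≢ b → τ a b x ≡ x
τ-elsewhere a b x x≢a x≢b rewrite dec-false (x ≟ a) x≢a | dec-false (x ≟ b) x≢b = refl

data Position {n} (a b x : Fin n) : Set where
  at-a : x ≡ a → Position a b x
  at-b : x ≡ b → Position a b x
  elsewhere : x ≢ a → x ≢ b → Position a b x

position : ∀ {n} (a b x : Fin n) → Position a b x
position a b x with x ≟ a | x ≟ b
... | yes x≡a | _ = at-a x≡a
... | no _ | yes x≡b = at-b x≡b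
... | no x≢a | no x≢b = elsewhere x≢a x≢b

τ-symmetric : ∀ {n} (a b : Fin n) → a ≢ b → ∀ x → τ a b x ≡ τ b a x
τ-symmetric a b a≢b x with position a b x
... | at-a refl = trans (τ-at-a a b) (sym (τ-at-b b a (a≢b ∘ sym)))
... | at-b refl = trans (τ-at-b a b a≢b) (sym (τ-at-a b a))
... | elsewhere x≢a x≢b = trans (τ-elsewhere a b x x≢a x≢b) (sym (τ-elsewhere b a x x≢b x≢a))

τ-involutive : ∀ {n} (a b : Fin n) → a ≢ b → ∀ x → τ a b (τ a b x) ≡ x
τ-involutive a b a≢b x = trans (cong (τ a b) (τ-symmetric a b a≢b x)) (PC.transpose-inverse a b)

δ : ∀ {n} → Fin n → Fin n → ℕ
δ c x = 𝟙 (x ≟ c)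

δ-here : ∀ {n} (c : Fin n) → δ c c ≡ 1
δ-here c = 𝟙-yes (c ≟ c) refl

δ-away : ∀ {n} {c x : Fin n} → x ≢ c → δ c x ≡ 0
δ-away {c = c} {x} = 𝟙-no (x ≟ c)

sum-row : ∀ {n} (H : Fin n → Fin n → ℕ) (c : Fin n) → sum² (λ x y → δ c x * H x y) ≡ sum (H c)
sum-row H c = trans (sum-point (λ x → sum (λ y → δ c x * H x y)) c
    (λ x x≢c → sum-zero (λ y → δ c x * H x y) (λ y → cong (_* H x y) (δ-away x≢c))))
  (sum-cong-≗ (λ y → trans (cong (_* H c y) (δ-here c)) (NP.+-identityʳ (H c y))))

sum-column : ∀ {n} (H : Fin n → Fin n → ℕ) (c : Fin n) → sum² (λ x y → δ c y * H x y) ≡ sum (λ x → H x c)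
sum-column H c = sum-cong-≗ (λ x → trans (sum-point (λ y → δ c y * H x y) c (λ y y≢c → cong (_* H x y) (δ-away y≢c)))
  (trans (cong (_* H x c) (δ-here c)) (NP.+-identityʳ (H x c))))

sum-entry : ∀ {n} (H : Fin n → Fin n → ℕ) (c d : Fin n) → sum² (λ x y → δ c x * δ d y * H x y) ≡ H c d
sum-entry H c d = begin
    sum² (λ x y → δ c x * δ d y * H x y)
  ≡⟨ sum²-cong (λ x y → NP.*-assoc (δ c x) (δ d y) (H x y)) ⟩
    sum² (λ x y → δ c x * (δ d y * H x y))
  ≡⟨ sum-row (λ x y → δ d y * H x y) c ⟩
    sum (λ y → δ d y * H c y)
  ≡⟨ sum-point (λ y → δ d y * H c y) d (λ y y≢d → cong (_* H c y) (δ-away y≢d)) ⟩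
    δ d d * H c d
  ≡⟨ trans (cong (_* H c d) (δ-here d)) (NP.+-identityʳ (H c d)) ⟩
    H c d ∎
  where open ≡-Reasoning

-- Inclusion–exclusion over the rows and columns through two distinct points a, b of Fin n × Fin n:
-- two grids that vanish on the diagonal and agree off those lines differ, in total, exactly as
-- their restrictions to the lines do.
module Cross {n} (a b : Fin n) (a≢b : a ≢ b) where
  W D : Fin n → Fin n → ℕ
  W x y = (δ a x + δ a y) + (δ b x + δ b y)
  D x y = δ a x * δ b y + δ b x * δ a y

  cross : (Fin n → Fin n → ℕ) → Fin n → ℕ
  cross H y = (H a y + H y a) + (H b y + H y b)

  corners : (Fin n → Fin n → ℕ) → ℕ
  corners H = H a b + H b a

  sum-W : ∀ H → sum² (λ x y → W x y * H x y) ≡ sum (cross H)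
  sum-W H = begin
      sum² (λ x y → W x y * H x y)
    ≡⟨ sum²-cong (λ x y → distrib (δ a x) (δ a y) (δ b x) (δ b y) (H x y)) ⟩
      sum² (λ x y → (δ a x * H x y + δ a y * H x y) + (δ b x * H x y + δ b y * H x y))
    ≡⟨ sum²-+ (λ x y → δ a x * H x y + δ a y * H x y) (λ x y → δ b x * H x y + δ b y * H x y) ⟩
      sum² (λ x y → δ a x * H x y + δ a y * H x y) + sum² (λ x y → δ b x * H x y + δ b y * H x y)
    ≡⟨ cong₂ _+_ (lines a) (lines b) ⟩
      sum (λ y → H a y + H y a) + sum (λ y → H b y + H y b)
    ≡⟨ sym (∑-distrib-+ (λ y → H a y + H y a) (λ y → H b y + H y b)) ⟩
      sum (cross H) ∎
    where
    open ≡-Reasoning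
    distrib : ∀ p q r s h → ((p + q) + (r + s)) * h ≡ (p * h + q * h) + (r * h + s * h)
    distrib p q r s h = trans (NP.*-distribʳ-+ h (p + q) (r + s)) (cong₂ _+_ (NP.*-distribʳ-+ h p q) (NP.*-distribʳ-+ h r s))
    lines : ∀ c → sum² (λ x y → δ c x * H x y + δ c y * H x y) ≡ sum (λ y → H c y + H y c)
    lines c = trans (sum²-+ (λ x y → δ c x * H x y) (λ x y → δ c y * H x y))
      (trans (cong₂ _+_ (sum-row H c) (sum-column H c)) (sym (∑-distrib-+ (H c) (λ y → H y c))))

  sum-D : ∀ H → sum² (λ x y → D x y * H x y) ≡ corners H
  sum-D H = trans (sum²-cong (λ x y → NP.*-distribʳ-+ (H x y) (δ a x * δ b y) (δ b x * δ a y)))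
    (trans (sum²-+ (λ x y → δ a x * δ b y * H x y) (λ x y → δ b x * δ a y * H x y))
      (cong₂ _+_ (sum-entry H a b) (sum-entry H b a)))

  -- The arithmetic identity used wherever W = 1 + D.
  private
    rebalance : ∀ d p q → p + suc d * q + d * p ≡ q + suc d * p + d * q
    rebalance = solve 3 (λ d p q → p :+ (con 1 :+ d) :* q :+ d :* p := q :+ (con 1 :+ d) :* p :+ d :* q) refl
      where open +-*-Solver

  -- The pointwise identity behind the exchange: off the special lines E = F, and on them W = 1 + D
  -- (the diagonal points (a, a), (b, b) carry no weight).
  exchange-at : (E F : Fin n → Fin n → ℕ) → (∀ x → E x x ≡ 0) → (∀ x → F x x ≡ 0) →
    (∀ x y → x ≢ a → x ≢ b → y ≢ a → y ≢ b → E x y ≡ F x y) →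
    ∀ x y → E x y + W x y * F x y + D x y * E x y ≡ F x y + W x y * E x y + D x y * F x y
  exchange-at E F E0 F0 agree x y with position a b x | position a b y
  ... | at-a refl | at-a refl rewrite E0 a | F0 a = refl
  ... | at-b refl | at-b refl rewrite E0 b | F0 b = refl
  ... | at-a refl | at-b refl rewrite δ-here a | δ-away a≢b | δ-away (a≢b ∘ sym) | δ-here b = rebalance 1 (E a b) (F a b)
  ... | at-b refl | at-a refl rewrite δ-here a | δ-away a≢b | δ-away (a≢b ∘ sym) | δ-here b = rebalance 1 (E b a) (F b a)
  ... | at-a refl | elsewhere y≢a y≢b rewrite δ-here a | δ-away a≢b | δ-away y≢a | δ-away y≢b = rebalance 0 (E a y) (F a y)
  ... | at-b refl | elsewhere y≢a y≢b rewrite δ-here b | δ-away (a≢b ∘ sym) | δ-away y≢a | δ-away y≢b = rebalance 0 (E b y) (F b y)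
  ... | elsewhere x≢a x≢b | at-a refl rewrite δ-here a | δ-away a≢b | δ-away x≢a | δ-away x≢b = rebalance 0 (E x a) (F x a)
  ... | elsewhere x≢a x≢b | at-b refl rewrite δ-here b | δ-away (a≢b ∘ sym) | δ-away x≢a | δ-away x≢b = rebalance 0 (E x b) (F x b)
  ... | elsewhere x≢a x≢b | elsewhere y≢a y≢b rewrite agree x y x≢a x≢b y≢a y≢b = refl

  exchange : (E F : Fin n → Fin n → ℕ) → (∀ x → E x x ≡ 0) → (∀ x → F x x ≡ 0) →
    (∀ x y → x ≢ a → x ≢ b → y ≢ a → y ≢ b → E x y ≡ F x y) →
    sum² E + sum (cross F) + corners E ≡ sum² F + sum (cross E) + corners F
  exchange E F E0 F0 agree = begin
      sum² E + sum (cross F) + corners E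
    ≡⟨ sym (cong₂ (λ s t → sum² E + s + t) (sum-W F) (sum-D E)) ⟩
      sum² E + sum² (λ x y → W x y * F x y) + sum² (λ x y → D x y * E x y)
    ≡⟨ sym (sum²-+₃ E (λ x y → W x y * F x y) (λ x y → D x y * E x y)) ⟩
      sum² (λ x y → E x y + W x y * F x y + D x y * E x y)
    ≡⟨ sum²-cong (exchange-at E F E0 F0 agree) ⟩
      sum² (λ x y → F x y + W x y * E x y + D x y * F x y)
    ≡⟨ sum²-+₃ F (λ x y → W x y * E x y) (λ x y → D x y * F x y) ⟩
      sum² F + sum² (λ x y → W x y * E x y) + sum² (λ x y → D x y * F x y)
    ≡⟨ cong₂ (λ s t → sum² F + s + t) (sum-W E) (sum-D F) ⟩
      sum² F + sum (cross E) + corners F ∎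
    where open ≡-Reasoning

three-values : ∀ {n} {A B Y : Fin n} → A F.< B → Y ≢ A → Y ≢ B →
  𝟙 (Y <? B) + 𝟙 (A <? Y) ≡ 𝟙 (Y <? A) + 𝟙 (B <? Y) + (𝟙 ((A <? Y) ×-dec (Y <? B)) + 𝟙 ((A <? Y) ×-dec (Y <? B)))
three-values {A = A} {B} {Y} A<B Y≢A Y≢B with FP.<-cmp Y A | FP.<-cmp Y B
... | tri≈ _ Y≡A _ | _ = ⊥-elim (Y≢A Y≡A)
... | _ | tri≈ _ Y≡B _ = ⊥-elim (Y≢B Y≡B)
... | tri< Y<A _ _ | _
  rewrite dec-true (Y <? B) (NP.<-trans Y<A A<B) | dec-false (A <? Y) (NP.<-asym Y<A)
        | dec-true (Y <? A) Y<A | dec-false (B <? Y) (NP.<-asym (NP.<-trans Y<A A<B)) = refl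
... | tri> _ _ A<Y | tri< Y<B _ _
  rewrite dec-true (Y <? B) Y<B | dec-true (A <? Y) A<Y
        | dec-false (Y <? A) (NP.<-asym A<Y) | dec-false (B <? Y) (NP.<-asym Y<B) = refl
... | tri> _ _ A<Y | tri> _ _ B<Y
  rewrite dec-false (Y <? B) (NP.<-asym B<Y) | dec-true (A <? Y) A<Y
        | dec-false (Y <? A) (NP.<-asym A<Y) | dec-true (B <? Y) B<Y = refl

-- The length of u · (a b) for positions a < b with u a < u b: every point strictly between a and b
-- in position and in value adds two inversions, and the pair (a, b) itself adds one.
module TranspositionLength {n} (f g : Fin n → Fin n) {a b : Fin n} (a<b : a F.< b) (fa<fb : f a F.< f b)
  (f-injective : ∀ {x y} → f x ≡ f y → x ≡ y) (g≗fτ : ∀ x → g x ≡ f (τ a b x)) where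

  private
    a≢b : a ≢ b
    a≢b = FP.<⇒≢ a<b

  open Cross a b a≢b

  between : Fin n → ℕ
  between c = 𝟙 ((a <? c) ×-dec ((c <? b) ×-dec ((f a <? f c) ×-dec (f c <? f b))))

  gaps : ℕ
  gaps = sum between

  private
    g-at-a : g a ≡ f b
    g-at-a = trans (g≗fτ a) (cong f (τ-at-a a b))
    g-at-b : g b ≡ f a
    g-at-b = trans (g≗fτ b) (cong f (τ-at-b a b a≢b))
    g-elsewhere : ∀ {y} → y ≢ a → y ≢ b → g y ≡ f y
    g-elsewhere {y} y≢a y≢b = trans (g≗fτ y) (cong f (τ-elsewhere a b y y≢a y≢b))

    cross-at-a : (h : Fin n → Fin n) → cross (inv h) a ≡ 𝟙 (h b <? h a)
    cross-at-a h rewrite dec-false (a <? a) (FP.<-irrefl refl) | dec-false (b <? a) (NP.<-asym a<b) | dec-true (a <? b) a<b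
      = refl
    cross-at-b : (h : Fin n → Fin n) → cross (inv h) b ≡ 𝟙 (h b <? h a)
    cross-at-b h rewrite dec-false (b <? b) (FP.<-irrefl refl) | dec-false (b <? a) (NP.<-asym a<b) | dec-true (a <? b) a<b
      = trans (NP.+-identityʳ _) (NP.+-identityʳ _)
    cross-below : (h : Fin n → Fin n) {y : Fin n} → y F.< a → cross (inv h) y ≡ 𝟙 (h a <? h y) + 𝟙 (h b <? h y)
    cross-below h {y} y<a rewrite dec-false (a <? y) (NP.<-asym y<a) | dec-true (y <? a) y<a
      | dec-false (b <? y) (NP.<-asym (NP.<-trans y<a a<b)) | dec-true (y <? b) (NP.<-trans y<a a<b) = refl
    cross-above : (h : Fin n → Fin n) {y : Fin n} → b F.< y → cross (inv h) y ≡ 𝟙 (h y <? h a) + 𝟙 (h y <? h b)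
    cross-above h {y} b<y rewrite dec-true (a <? y) (NP.<-trans a<b b<y) | dec-false (y <? a) (NP.<-asym (NP.<-trans a<b b<y))
      | dec-true (b <? y) b<y | dec-false (y <? b) (NP.<-asym b<y) = cong₂ _+_ (NP.+-identityʳ (𝟙 (h y <? h a))) (NP.+-identityʳ (𝟙 (h y <? h b)))
    cross-inside : (h : Fin n → Fin n) {y : Fin n} → a F.< y → y F.< b → cross (inv h) y ≡ 𝟙 (h y <? h a) + 𝟙 (h b <? h y)
    cross-inside h {y} a<y y<b rewrite dec-true (a <? y) a<y | dec-false (y <? a) (NP.<-asym a<y)
      | dec-false (b <? y) (NP.<-asym y<b) | dec-true (y <? b) y<b = cong (_+ 𝟙 (h b <? h y)) (NP.+-identityʳ (𝟙 (h y <? h a)))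

  cross-step : ∀ y → cross (inv g) y ≡ cross (inv f) y + (between y + between y) + (δ a y + δ b y)
  cross-step y with position a b y
  ... | at-a refl rewrite cross-at-a g | cross-at-a f | g-at-a | g-at-b | dec-true (f a <? f b) fa<fb
      | dec-false (f b <? f a) (NP.<-asym fa<fb) | dec-false (a <? a) (FP.<-irrefl refl) | δ-here a | δ-away a≢b = refl
  ... | at-b refl rewrite cross-at-b g | cross-at-b f | g-at-a | g-at-b | dec-true (f a <? f b) fa<fb
      | dec-false (f b <? f a) (NP.<-asym fa<fb) | dec-false (b <? b) (FP.<-irrefl refl) | δ-here b | δ-away (a≢b ∘ sym)
      | dec-true (a <? b) a<b = refl
  ... | elsewhere y≢a y≢b rewrite δ-away y≢a | δ-away y≢b | NP.+-identityʳ (cross (inv f) y + (between y + between y))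
      with FP.<-cmp y a | FP.<-cmp y b
  ...   | tri≈ _ y≡a _ | _ = ⊥-elim (y≢a y≡a)
  ...   | _ | tri≈ _ y≡b _ = ⊥-elim (y≢b y≡b)
  ...   | tri< y<a _ _ | _ rewrite cross-below g y<a | cross-below f y<a | g-at-a | g-at-b | g-elsewhere y≢a y≢b
      | dec-false (a <? y) (NP.<-asym y<a)
      = trans (NP.+-comm (𝟙 (f b <? f y)) (𝟙 (f a <? f y))) (sym (NP.+-identityʳ (𝟙 (f a <? f y) + 𝟙 (f b <? f y))))
  ...   | tri> _ _ a<y | tri> _ _ b<y rewrite cross-above g b<y | cross-above f b<y | g-at-a | g-at-b | g-elsewhere y≢a y≢b
      | dec-false (y <? b) (NP.<-asym b<y) | dec-true (a <? y) a<y
      = trans (NP.+-comm (𝟙 (f y <? f b)) (𝟙 (f y <? f a))) (sym (NP.+-identityʳ (𝟙 (f y <? f a) + 𝟙 (f y <? f b))))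
  ...   | tri> _ _ a<y | tri< y<b _ _ rewrite cross-inside g a<y y<b | cross-inside f a<y y<b | g-at-a | g-at-b
      | g-elsewhere y≢a y≢b | dec-true (a <? y) a<y | dec-true (y <? b) y<b
      = three-values fa<fb (y≢a ∘ f-injective) (y≢b ∘ f-injective)

  private
    corners-g : corners (inv g) ≡ 1
    corners-g = cong₂ _+_ (trans (inv-< g a<b) (𝟙-yes (g b <? g a) (subst₂ F._<_ (sym g-at-b) (sym g-at-a) fa<fb)))
                          (inv-≮ g (NP.<-asym a<b))
    corners-f : corners (inv f) ≡ 0
    corners-f = cong₂ _+_ (trans (inv-< f a<b) (𝟙-no (f b <? f a) (NP.<-asym fa<fb))) (inv-≮ f (NP.<-asym a<b))

    sum-δ : (c : Fin n) → sum (δ c) ≡ 1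
    sum-δ c = trans (sum-point (δ c) c (λ x → δ-away {c = c} {x})) (δ-here c)

    sum-cross : sum (cross (inv g)) ≡ sum (cross (inv f)) + (gaps + gaps) + 2
    sum-cross = begin
        sum (cross (inv g))
      ≡⟨ sum-cong-≗ cross-step ⟩
        sum (λ y → cross (inv f) y + (between y + between y) + (δ a y + δ b y))
      ≡⟨ ∑-distrib-+ (λ y → cross (inv f) y + (between y + between y)) (λ y → δ a y + δ b y) ⟩
        sum (λ y → cross (inv f) y + (between y + between y)) + sum (λ y → δ a y + δ b y)
      ≡⟨ cong₂ _+_ (trans (∑-distrib-+ (cross (inv f)) (λ y → between y + between y))
                          (cong (sum (cross (inv f)) +_) (∑-distrib-+ between between)))
                   (trans (∑-distrib-+ (δ a) (δ b)) (cong₂ _+_ (sum-δ a) (sum-δ b))) ⟩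
        sum (cross (inv f)) + (gaps + gaps) + 2 ∎
      where open ≡-Reasoning

    inv-agrees : ∀ x y → x ≢ a → x ≢ b → y ≢ a → y ≢ b → inv g x y ≡ inv f x y
    inv-agrees x y x≢a x≢b y≢a y≢b rewrite g-elsewhere x≢a x≢b | g-elsewhere y≢a y≢b = refl

    inv-diagonal : (h : Fin n → Fin n) (x : Fin n) → inv h x x ≡ 0
    inv-diagonal h x = inv-≮ h {x} {x} (FP.<-irrefl refl)

  ℓ-formula : invs g ≡ suc (invs f + (gaps + gaps))
  ℓ-formula = NP.+-cancelˡ-≡ (X + 1) (invs g) (suc (invs f + (gaps + gaps))) (begin
      X + 1 + invs g
    ≡⟨ solve 2 (λ x G → x :+ con 1 :+ G := G :+ x :+ con 1) refl X (invs g) ⟩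
      invs g + X + 1
    ≡⟨ cong (invs g + X +_) (sym corners-g) ⟩
      invs g + sum (cross (inv f)) + corners (inv g)
    ≡⟨ exchange (inv g) (inv f) (inv-diagonal g) (inv-diagonal f) inv-agrees ⟩
      invs f + sum (cross (inv g)) + corners (inv f)
    ≡⟨ cong₂ (λ s t → invs f + s + t) sum-cross corners-f ⟩
      invs f + (X + (gaps + gaps) + 2) + 0
    ≡⟨ solve 3 (λ x F m → F :+ (x :+ m :+ con 2) :+ con 0 := x :+ con 1 :+ (con 1 :+ (F :+ m))) refl X (invs f) (gaps + gaps) ⟩
      X + 1 + suc (invs f + (gaps + gaps)) ∎)
    where
    open ≡-Reasoning
    open +-*-Solver
    X : ℕ
    X = sum (cross (inv f))

NoValueBetween : ∀ {n} → Perm n → Fin n → Fin n → Set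
NoValueBetween u a b = ∀ c → a F.< c → c F.< b → u ⟨$⟩ʳ a F.< u ⟨$⟩ʳ c → u ⟨$⟩ʳ c F.< u ⟨$⟩ʳ b → ⊥

ℓ-increases : ∀ {n} (u v : Perm n) {a b : Fin n} → a F.< b → (∀ x → v ⟨$⟩ʳ x ≡ u ⟨$⟩ʳ τ a b x) →
  u ⟨$⟩ʳ a F.< u ⟨$⟩ʳ b → ℓ u ℕ.< ℓ v
ℓ-increases u v a<b v≗uτ ua<ub = begin-strict
    ℓ u                                 ≡⟨ ℓ≡invs u ⟩
    invs (u ⟨$⟩ʳ_)                     <⟨ s≤s (NP.m≤m+n _ _) ⟩
    suc (invs (u ⟨$⟩ʳ_) + (gaps + gaps)) ≡⟨ sym ℓ-formula ⟩
    invs (v ⟨$⟩ʳ_)                     ≡⟨ sym (ℓ≡invs v) ⟩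
    ℓ v ∎
  where
  open NP.≤-Reasoning
  open TranspositionLength (u ⟨$⟩ʳ_) (v ⟨$⟩ʳ_) a<b ua<ub (perm-injective u) v≗uτ

cover-shape : ∀ {n} (u v : Perm n) {a b : Fin n} → a F.< b → (∀ x → v ⟨$⟩ʳ x ≡ u ⟨$⟩ʳ τ a b x) →
  ℓ v ≡ suc (ℓ u) → u ⟨$⟩ʳ a F.< u ⟨$⟩ʳ b × NoValueBetween u a b
cover-shape u v {a} {b} a<b v≗uτ ℓv≡1+ℓu with FP.<-cmp (u ⟨$⟩ʳ a) (u ⟨$⟩ʳ b)
... | tri≈ _ ua≡ub _ = ⊥-elim (FP.<⇒≢ a<b (perm-injective u ua≡ub))
... | tri> _ _ ub<ua = ⊥-elim (NP.<-asym ℓ-increases-back (NP.≤-reflexive (sym ℓv≡1+ℓu)))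
  where
  a≢b : a ≢ b
  a≢b = FP.<⇒≢ a<b
  u≗vτ : ∀ x → u ⟨$⟩ʳ x ≡ v ⟨$⟩ʳ τ a b x
  u≗vτ x = sym (trans (v≗uτ (τ a b x)) (cong (u ⟨$⟩ʳ_) (τ-involutive a b a≢b x)))
  ℓ-increases-back : ℓ v ℕ.< ℓ u
  ℓ-increases-back = ℓ-increases v u a<b u≗vτ
    (subst₂ F._<_ (sym (trans (v≗uτ a) (cong (u ⟨$⟩ʳ_) (τ-at-a a b))))
                  (sym (trans (v≗uτ b) (cong (u ⟨$⟩ʳ_) (τ-at-b a b a≢b)))) ub<ua)
... | tri< ua<ub _ _ = ua<ub , no-value-between
  where
  open TranspositionLength (u ⟨$⟩ʳ_) (v ⟨$⟩ʳ_) a<b ua<ub (perm-injective u) v≗uτ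
  no-gaps : gaps + gaps ≡ 0
  no-gaps = NP.+-cancelˡ-≡ (invs (u ⟨$⟩ʳ_)) (gaps + gaps) 0
    (NP.suc-injective (begin
      suc (invs (u ⟨$⟩ʳ_) + (gaps + gaps)) ≡⟨ sym ℓ-formula ⟩
      invs (v ⟨$⟩ʳ_)                       ≡⟨ sym (ℓ≡invs v) ⟩
      ℓ v                                  ≡⟨ ℓv≡1+ℓu ⟩
      suc (ℓ u)                            ≡⟨ cong suc (trans (ℓ≡invs u) (sym (NP.+-identityʳ _))) ⟩
      suc (invs (u ⟨$⟩ʳ_) + 0) ∎))
    where open ≡-Reasoning
  no-value-between : NoValueBetween u a b
  no-value-between c a<c c<b ua<uc uc<ub = NP.<-irrefl refl (begin-strict
    0         <⟨ s≤s z≤n ⟩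
    1         ≡⟨ sym (𝟙-yes ((a <? c) ×-dec ((c <? b) ×-dec ((u ⟨$⟩ʳ a <? u ⟨$⟩ʳ c) ×-dec (u ⟨$⟩ʳ c <? u ⟨$⟩ʳ b))))
                              (a<c , c<b , ua<uc , uc<ub)) ⟩
    between c ≤⟨ term≤sum between c ⟩
    gaps      ≡⟨ NP.m+n≡0⇒m≡0 gaps no-gaps ⟩
    0 ∎)
    where open NP.≤-Reasoning

PreservesBlock : ∀ {n} → ℕ → (Fin n → Fin n) → Set
PreservesBlock k h = ∀ x → (toℕ x ℕ.< k → toℕ (h x) ℕ.< k) × (toℕ (h x) ℕ.< k → toℕ x ℕ.< k)

preserves-∘ : ∀ {n} k (g h : Fin n → Fin n) → PreservesBlock k g → PreservesBlock k h → PreservesBlock k (g ∘ h)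
preserves-∘ k g h pg ph x = proj₁ (pg (h x)) ∘ proj₁ (ph x) , proj₂ (ph x) ∘ proj₂ (pg (h x))

preserves-inverse : ∀ {n} k (z : Perm n) → PreservesBlock k (z ⟨$⟩ʳ_) → PreservesBlock k (z ⟨$⟩ˡ_)
preserves-inverse k z pz x =
  (λ x<k → proj₂ (pz (z ⟨$⟩ˡ x)) (subst (λ y → toℕ y ℕ.< k) (sym (inverseʳ z)) x<k)) ,
  (λ σx<k → subst (λ y → toℕ y ℕ.< k) (inverseʳ z) (proj₁ (pz (z ⟨$⟩ˡ x)) σx<k))

preserves-τ : ∀ {n} k {a b : Fin n} → a ≢ b → (toℕ a ℕ.< k → toℕ b ℕ.< k) → (toℕ b ℕ.< k → toℕ a ℕ.< k) →
  PreservesBlock k (τ a b)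
preserves-τ k {a} {b} a≢b a→b b→a x with position a b x
... | at-a refl rewrite τ-at-a a b = a→b , b→a
... | at-b refl rewrite τ-at-b a b a≢b = b→a , a→b
... | elsewhere x≢a x≢b rewrite τ-elsewhere a b x x≢a x≢b = id , id

image-invariant : ∀ {n} k (u z : Perm n) → PreservesBlock k (z ⟨$⟩ʳ_) → ∀ y → InImage k u y ⇔ InImage k (u · z) y
image-invariant k u z pz y = mk⇔
  (λ (i , i<k , ui≡y) → z ⟨$⟩ˡ i , proj₁ (preserves-inverse k z pz i) i<k , trans (cong (u ⟨$⟩ʳ_) (inverseʳ z)) ui≡y)
  (λ (i , i<k , uzi≡y) → z ⟨$⟩ʳ i , proj₁ (pz i) i<k , uzi≡y)

image-pointwise : ∀ {n} k {u v : Perm n} → (∀ x → u ⟨$⟩ʳ x ≡ v ⟨$⟩ʳ x) → ∀ y → InImage k u y ⇔ InImage k v y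
image-pointwise k u≗v y = mk⇔ (λ (i , i<k , ui≡y) → i , i<k , trans (sym (u≗v i)) ui≡y)
                              (λ (i , i<k , vi≡y) → i , i<k , trans (u≗v i) vi≡y)

image-τ : ∀ {n} k (u v : Perm n) {a b : Fin n} → a ≢ b → (∀ x → v ⟨$⟩ʳ x ≡ u ⟨$⟩ʳ τ a b x) →
  (toℕ a ℕ.< k → toℕ b ℕ.< k) → (toℕ b ℕ.< k → toℕ a ℕ.< k) → SameImage k u v
image-τ k u v {a} {b} a≢b v≗uτ a→b b→a y =
  ⇔-trans (image-invariant k u (P.transpose a b) (preserves-τ k a≢b a→b b→a) y) (image-pointwise k {u · P.transpose a b} {v} (sym ∘ v≗uτ) y)

cover-crosses : ∀ {n} k (u v : Perm n) {a b : Fin n} → a F.< b → (∀ x → v ⟨$⟩ʳ x ≡ u ⟨$⟩ʳ τ a b x) →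
  ¬ SameImage k u v → toℕ a ℕ.< k × ¬ toℕ b ℕ.< k
cover-crosses k u v {a} {b} a<b v≗uτ changes with toℕ a ℕ.<? k | toℕ b ℕ.<? k
... | yes a<k | no b≮k = a<k , b≮k
... | yes a<k | yes b<k = ⊥-elim (changes (image-τ k u v (FP.<⇒≢ a<b) v≗uτ (λ _ → b<k) (λ _ → a<k)))
... | no a≮k | no b≮k = ⊥-elim (changes (image-τ k u v (FP.<⇒≢ a<b) v≗uτ (⊥-elim ∘ a≮k) (⊥-elim ∘ b≮k)))
... | no a≮k | yes b<k = ⊥-elim (a≮k (NP.<-trans a<b b<k))

-- Positions i < j lie in the same block, [k] or its complement.
SameBlock : ∀ {n} → ℕ → Fin n → Fin n → Set
SameBlock k i j = toℕ j ℕ.< k ⊎ k ℕ.≤ toℕ i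

BlockAscent : ∀ {n} → ℕ → Perm n → Set
BlockAscent {n} k v = Σ (Fin n) λ i → Σ (Fin n) λ j → i F.< j × SameBlock k i j × v ⟨$⟩ʳ i F.< v ⟨$⟩ʳ j

module _ {n} (k : ℕ) (v : Perm n) where
  private
    Descends : Fin n → Fin n → Set
    Descends i j = i F.< j → SameBlock k i j → v ⟨$⟩ʳ j F.< v ⟨$⟩ʳ i

    descends? : ∀ i j → Dec (Descends i j)
    descends? i j = (i <? j) →-dec (((toℕ j ℕ.<? k) ⊎-dec (k ℕ.≤? toℕ i)) →-dec (v ⟨$⟩ʳ j <? v ⟨$⟩ʳ i))

    ascent : ∀ i j → ¬ Descends i j → BlockAscent k v
    ascent i j ¬descends with i <? j | (toℕ j ℕ.<? k) ⊎-dec (k ℕ.≤? toℕ i) | v ⟨$⟩ʳ j <? v ⟨$⟩ʳ i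
    ... | no i≮j | _ | _ = ⊥-elim (¬descends (⊥-elim ∘ i≮j))
    ... | yes _ | no different | _ = ⊥-elim (¬descends (λ _ same → ⊥-elim (different same)))
    ... | yes _ | yes _ | yes vj<vi = ⊥-elim (¬descends (λ _ _ → vj<vi))
    ... | yes i<j | yes same | no vj≮vi =
      i , j , i<j , same , FP.≤∧≢⇒< (NP.≮⇒≥ vj≮vi) (FP.<⇒≢ i<j ∘ perm-injective v)

  block-ascent-or-antiGrassmannian : BlockAscent k v ⊎ AntiGrassmannian k v
  block-ascent-or-antiGrassmannian with FP.all? (λ i → FP.all? (descends? i))
  ... | yes descends = inj₂ ((λ i j i<j j<k → descends i j i<j (inj₁ j<k)) , (λ i j i<j k≤i → descends i j i<j (inj₂ k≤i)))
  ... | no ¬descends with FP.¬∀⟶∃¬ n _ (λ i → FP.all? (descends? i)) ¬descends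
  ...   | i , ¬descends-i with FP.¬∀⟶∃¬ n _ (descends? i) ¬descends-i
  ...     | j , ¬descends-ij = inj₁ (ascent i j ¬descends-ij)

  swap-ascent : BlockAscent k v → Σ (Perm n) λ t → PreservesBlock k (t ⟨$⟩ʳ_) × ℓ v ℕ.< ℓ (v · t)
  swap-ascent (i , j , i<j , same , vi<vj) =
    P.transpose i j , preserves-τ k (FP.<⇒≢ i<j) i→j (NP.<-trans i<j) , ℓ-increases v (v · P.transpose i j) i<j (λ _ → refl) vi<vj
    where
    i→j : toℕ i ℕ.< k → toℕ j ℕ.< k
    i→j i<k = [ id , (λ k≤i → ⊥-elim (NP.<-irrefl refl (NP.<-≤-trans i<k k≤i))) ] same

-- Every v has a block-preserving z with v · z anti-Grassmannian: swap block ascents while they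
-- exist.  Each swap raises ℓ, which never exceeds n * n, so n * n swaps always suffice.
block-sort : ∀ {n} k (fuel : ℕ) (v : Perm n) → n * n ℕ.≤ ℓ v + fuel →
  Σ (Perm n) λ z → PreservesBlock k (z ⟨$⟩ʳ_) × AntiGrassmannian k (v · z)
block-sort k fuel v bound with block-ascent-or-antiGrassmannian k v
... | inj₂ antiGrassmannian = P.id , (λ _ → id , id) , antiGrassmannian
... | inj₁ asc with swap-ascent k v asc | fuel
...   | t , t-preserves , longer | zero =
  ⊥-elim (NP.<-irrefl refl (NP.<-≤-trans longer (NP.≤-trans (ℓ≤n*n (v · t)) (NP.≤-trans bound (NP.≤-reflexive (NP.+-identityʳ (ℓ v)))))))
...   | t , t-preserves , longer | suc fuel′
  with block-sort k fuel′ (v · t) (NP.≤-trans bound (NP.≤-trans (NP.≤-reflexive (NP.+-suc (ℓ v) fuel′)) (NP.+-monoˡ-≤ fuel′ longer)))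
...     | z , z-preserves , antiGrassmannian = t · z , preserves-∘ k (t ⟨$⟩ʳ_) (z ⟨$⟩ʳ_) t-preserves z-preserves , antiGrassmannian

τ-conjugate : ∀ {n} (z : Perm n) (a b : Fin n) → a ≢ b → ∀ x → τ a b (z ⟨$⟩ʳ x) ≡ z ⟨$⟩ʳ τ (z ⟨$⟩ˡ a) (z ⟨$⟩ˡ b) x
τ-conjugate z a b a≢b x with position (z ⟨$⟩ˡ a) (z ⟨$⟩ˡ b) x
... | at-a refl rewrite τ-at-a (z ⟨$⟩ˡ a) (z ⟨$⟩ˡ b) =
  trans (cong (τ a b) (inverseʳ z)) (trans (τ-at-a a b) (sym (inverseʳ z)))
... | at-b refl rewrite τ-at-b (z ⟨$⟩ˡ a) (z ⟨$⟩ˡ b) (a≢b ∘ perm-injective (flip z)) =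
  trans (cong (τ a b) (inverseʳ z)) (trans (τ-at-b a b a≢b) (sym (inverseʳ z)))
... | elsewhere x≢σa x≢σb rewrite τ-elsewhere (z ⟨$⟩ˡ a) (z ⟨$⟩ˡ b) x x≢σa x≢σb =
  τ-elsewhere a b (z ⟨$⟩ʳ x) (moved x≢σa) (moved x≢σb)
  where
  moved : ∀ {c} → x ≢ z ⟨$⟩ˡ c → z ⟨$⟩ʳ x ≢ c
  moved x≢σc zx≡c = x≢σc (trans (sym (inverseˡ z)) (cong (z ⟨$⟩ˡ_) zx≡c))

flip-< : ∀ {n} {x y : Fin n} → ¬ x F.< y → x ≢ y → y F.< x
flip-< x≮y x≢y = FP.≤∧≢⇒< (NP.≮⇒≥ x≮y) (x≢y ∘ sym)

module Transport {n} (k : ℕ) (z : Perm n) (z-preserves : PreservesBlock k (z ⟨$⟩ʳ_)) where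
  private
    σ : Fin n → Fin n
    σ = z ⟨$⟩ˡ_
    σ-preserves : PreservesBlock k σ
    σ-preserves = preserves-inverse k z z-preserves

  inversion-in-block : ∀ {p q} → σ p F.< σ q → q F.< p → toℕ q ℕ.< k → toℕ p ℕ.< k
  inversion-in-block {p} {q} σp<σq q<p q<k with toℕ p ℕ.<? k
  ... | yes p<k = p<k
  ... | no p≮k = ⊥-elim (NP.<-asym σp<σq (NP.<-≤-trans (proj₁ (σ-preserves q) q<k) (NP.≮⇒≥ (p≮k ∘ proj₂ (σ-preserves p)))))

  -- The heart of the argument: a k-cover u ⋖ₖ v = u · (a b) swaps an ascent a ∈ [k] ∌ b of u with
  -- no value in between, and such a swap cannot destroy compatibility with z.
  compatible-step : (u v : Perm n) {a b : Fin n} → a F.< b → toℕ a ℕ.< k → ¬ toℕ b ℕ.< k →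
    u ⟨$⟩ʳ a F.< u ⟨$⟩ʳ b → NoValueBetween u a b → (∀ x → v ⟨$⟩ʳ x ≡ u ⟨$⟩ʳ τ a b x) →
    Compatible z u → Compatible z v
  compatible-step u v {a} {b} a<b a<k b≮k ua<ub no-between v≗uτ compat-u p q σp<σq q<p =
    subst₂ F._<_ (sym (v≗uτ q)) (sym (v≗uτ p)) (swapped (position a b p) (position a b q))
    where
    U : Fin n → Fin n
    U = u ⟨$⟩ʳ_
    same-block : toℕ q ℕ.< k → toℕ p ℕ.< k
    same-block = inversion-in-block σp<σq q<p
    compat : U q F.< U p
    compat = compat-u p q σp<σq q<p
    swapped : Position a b p → Position a b q → U (τ a b q) F.< U (τ a b p)
    swapped (at-a refl) (at-a refl) = ⊥-elim (FP.<-irrefl refl q<p)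
    swapped (at-b refl) (at-b refl) = ⊥-elim (FP.<-irrefl refl q<p)
    swapped (at-a refl) (at-b refl) = ⊥-elim (NP.<-asym a<b q<p)
    swapped (at-b refl) (at-a refl) = ⊥-elim (b≮k (same-block a<k))
    swapped (at-a refl) (elsewhere q≢a q≢b) rewrite τ-at-a a b | τ-elsewhere a b q q≢a q≢b =
      NP.<-trans compat ua<ub
    swapped (elsewhere p≢a p≢b) (at-b refl) rewrite τ-at-b a b (FP.<⇒≢ a<b) | τ-elsewhere a b p p≢a p≢b =
      NP.<-trans ua<ub compat
    swapped (elsewhere p≢a p≢b) (at-a refl) rewrite τ-at-a a b | τ-elsewhere a b p p≢a p≢b =
      flip-< (no-between p q<p p<b compat) (p≢b ∘ perm-injective u)
      where
      p<b : p F.< b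
      p<b = NP.<-≤-trans (same-block a<k) (NP.≮⇒≥ b≮k)
    swapped (at-b refl) (elsewhere q≢a q≢b) rewrite τ-at-b a b (FP.<⇒≢ a<b) | τ-elsewhere a b q q≢a q≢b =
      flip-< (λ ua<uq → no-between q a<q q<p ua<uq compat) (q≢a ∘ perm-injective u ∘ sym)
      where
      a<q : a F.< q
      a<q = NP.<-≤-trans a<k (NP.≮⇒≥ (b≮k ∘ same-block))
    swapped (elsewhere p≢a p≢b) (elsewhere q≢a q≢b) rewrite τ-elsewhere a b p p≢a p≢b | τ-elsewhere a b q q≢a q≢b =
      compat

  compatible-cover : (u v : Perm n) {a b : Fin n} → a F.< b → (∀ x → v ⟨$⟩ʳ x ≡ u ⟨$⟩ʳ τ a b x) →
    ℓ v ≡ suc (ℓ u) → ¬ SameImage k u v → Compatible z u → Compatible z v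
  compatible-cover u v a<b v≗uτ ℓv≡1+ℓu changes
    with cover-shape u v a<b v≗uτ ℓv≡1+ℓu | cover-crosses k u v a<b v≗uτ changes
  ... | ua<ub , no-between | a<k , b≮k = compatible-step u v a<b a<k b≮k ua<ub no-between v≗uτ

  -- A k-cover u ⋖ₖ v with u compatible with z yields the k-cover u z ⋖ₖ v z, and v is compatible:
  -- the transposition (a b) becomes (z⁻¹a z⁻¹b), lengths add, and images of [k] are unchanged.
  cover-transport : (u v : Perm n) → kCover k u v → Compatible z u → Compatible z v × kCover k (u · z) (v · z)
  cover-transport u v ((a , b , a≢b , v≗uτ , ℓv≡1+ℓu) , changes) compat-u =
    compat-v , ((σ a , σ b , a≢b ∘ perm-injective (flip z) , v·z≗ , ℓ-step) , changes·z)
    where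
    compat-v : Compatible z v
    compat-v with FP.<-cmp a b
    ... | tri< a<b _ _ = compatible-cover u v a<b v≗uτ ℓv≡1+ℓu changes compat-u
    ... | tri≈ _ a≡b _ = ⊥-elim (a≢b a≡b)
    ... | tri> _ _ b<a = compatible-cover u v b<a (λ x → trans (v≗uτ x) (cong (u ⟨$⟩ʳ_) (τ-symmetric a b a≢b x)))
                           ℓv≡1+ℓu changes compat-u
    v·z≗ : ∀ x → (v · z) ⟨$⟩ʳ x ≡ ((u · z) · P.transpose (σ a) (σ b)) ⟨$⟩ʳ x
    v·z≗ x = trans (v≗uτ (z ⟨$⟩ʳ x)) (cong (u ⟨$⟩ʳ_) (τ-conjugate z a b a≢b x))
    ℓ-step : ℓ (v · z) ≡ suc (ℓ (u · z))
    ℓ-step = trans (ℓ-additive z v compat-v) (trans (cong (_+ ℓ z) ℓv≡1+ℓu) (cong suc (sym (ℓ-additive z u compat-u))))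
    changes·z : ¬ SameImage k (u · z) (v · z)
    changes·z same = changes (λ y → ⇔-trans (image-invariant k u z z-preserves y)
                                           (⇔-trans (same y) (⇔-sym (image-invariant k v z z-preserves y))))

  chain-transport : (u w : Perm n) → u ≤[ k ] w → Compatible z u → ((u · z) ≤[ k ] (w · z)) × Compatible z w
  chain-transport u w (≤-refl u≗w) compat-u =
    ≤-refl (u≗w ∘ (z ⟨$⟩ʳ_)) , (λ p q σp<σq q<p → subst₂ F._<_ (u≗w q) (u≗w p) (compat-u p q σp<σq q<p))
  chain-transport u w (≤-step {v = v} cover rest) compat-u with cover-transport u v cover compat-u
  ... | compat-v , cover·z with chain-transport v w rest compat-v
  ... | chain·z , compat-w = ≤-step cover·z chain·z , compat-w

  -- If u · z is anti-Grassmannian then u is compatible with z: an inversion of z⁻¹ lies in a block,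
  -- where u · z decreases.
  antiGrassmannian-compatible : (u : Perm n) → AntiGrassmannian k (u · z) → Compatible z u
  antiGrassmannian-compatible u (decreasing-in , decreasing-out) p q σp<σq q<p
    with toℕ (σ q) ℕ.<? k
  ... | yes σq<k = subst₂ F._<_ (cong (u ⟨$⟩ʳ_) (inverseʳ z)) (cong (u ⟨$⟩ʳ_) (inverseʳ z)) (decreasing-in (σ p) (σ q) σp<σq σq<k)
  ... | no σq≮k = subst₂ F._<_ (cong (u ⟨$⟩ʳ_) (inverseʳ z)) (cong (u ⟨$⟩ʳ_) (inverseʳ z)) (decreasing-out (σ p) (σ q) σp<σq k≤σp)
    where
    k≤σp : k ℕ.≤ toℕ (σ p)
    k≤σp = NP.≮⇒≥ (λ σp<k → σq≮k (proj₁ (σ-preserves q) (NP.<-trans q<p (proj₂ (σ-preserves p) σp<k))))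

-- Sort u within the blocks to obtain z; u is then compatible with z, and transporting the
-- k-chain from u to w yields u z ≤ₖ w z together with compatibility of w, so lengths add at both ends.
lemma3p2 : (n k : ℕ) → 1 ≤ k → k ≤ n → (u w : Perm n) → u ≤[ k ] w →
    Σ (Perm n) λ z → InYoung k z ×
      ((u · z) ≤[ k ] (w · z)) × AntiGrassmannian k (u · z) ×
      (ℓ (u · z) ≡ ℓ u + ℓ z) × (ℓ (w · z) ≡ ℓ w + ℓ z)
lemma3p2 n k _ _ u w u≤w with block-sort k (n * n) u (NP.m≤n+m (n * n) (ℓ u))
... | z , z-preserves , antiGrassmannian =
  z , (λ i → proj₁ (z-preserves i)) , proj₁ transported , antiGrassmannian ,
  ℓ-additive z u compat-u , ℓ-additive z w (proj₂ transported)
  where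
  open Transport k z z-preserves
  compat-u : Compatible z u
  compat-u = antiGrassmannian-compatible u antiGrassmannian
  transported : ((u · z) ≤[ k ] (w · z)) × Compatible z w
  transported = chain-transport u w u≤w compat-u
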